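{- Let $\Sigma$ be a finite alphabet of numbers with $\sigma=|\Sigma|$. Let $P_1', \dots, P_k'$ be $k$ strings of length $m$ over $\Sigma$ and let $1 \le b \le m$, $b \le \sigma$, be such that every substring of length $b$ of every $P_i'$ has pairwise distinct characters. For a block $x$ (a string of length $b$ over $\Sigma$), define $l_x = \max\{ j : b \le j \le m,\ \exists i \in \{1,\dots,k\} \text{ with } Pre(P_i'[j-b+1..j]) = Pre(x) \}$, with $l_x = -\infty$ if no such $j$ exists, and define the shift value of $x$ as $\min(m - l_x,\ m-b+1)$. Let $x$ be chosen uniformly at random among the ${}_\sigma P_b=\sigma!/(\sigma-b)!$ strings of length $b$ over $\Sigma$ with pairwise distinct characters. Then for every integer $j$ with $0 \le j \le m-b$, the probability that the shift value of $x$ equals $j$ is at most $\frac{k}{b!}$.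
   Context: For a string $z$ and a character $c$, $rank_z(c) = 1 + |\{ i : z[i] < c,\ 1 \le i \le |z| \}|$. With $z_i = z[1..i]$ the prefix of length $i$, the prefix representation is $Pre(z) = (rank_{z_1}(z[1]), \dots, rank_{z_{|z|}}(z[|z|]))$. The notation $z[a..c]$ denotes the substring $(z[a], z[a+1], \dots, z[c])$. -}

module Defs where

open import Data.Nat using (ℕ; zero; suc; _+_; _*_; _∸_; _⊔_; _⊓_)
open import Data.Nat.Properties using () renaming (_≟_ to _≟ℕ_)
open import Data.Fin using (Fin; _<?_)
open import Data.Fin.Properties using () renaming (_≟_ to _≟F_)
open import Data.List using (List; []; _∷_; [_]; _++_; length; filter; take; drop; map; upTo; allFin; concatMap)
open import Data.Bool.ListAction using (any)
open import Data.List.Properties using (≡-dec)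
open import Data.Vec using (Vec; toList) renaming ([] to []ᵥ; _∷_ to _∷ᵥ_)
open import Data.Maybe using (Maybe; just; nothing; maybe)
open import Data.Bool using (Bool)
open import Relation.Nullary using (does)
open import Relation.Unary using (Decidable)
open import Data.List.Relation.Unary.Unique.Propositional using (Unique)
import Data.List.Relation.Unary.Unique.DecPropositional as UD

-- The ordered alphabet Σ is represented by Fin σ with its natural order.

rank : ∀ {σ} → List (Fin σ) → Fin σ → ℕ
rank z c = suc (length (filter (λ a → a <? c) z))

-- Pre(z) = (rank_{z_1}(z[1]), ..., rank_{z_|z|}(z[|z|])), z_i the prefix of length i
preAux : ∀ {σ} → List (Fin σ) → List (Fin σ) → List ℕ
preAux acc [] = []
preAux acc (c ∷ cs) = rank (acc ++ [ c ]) c ∷ preAux (acc ++ [ c ]) cs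

Pre : ∀ {σ} → List (Fin σ) → List ℕ
Pre z = preAux [] z

-- z[a..c] (1-indexed, inclusive): the substring of length c - a + 1 starting at position a
substr : ∀ {σ} → List (Fin σ) → ℕ → ℕ → List (Fin σ)
substr z a c = take (suc c ∸ a) (drop (a ∸ 1) z)

Distinct : ∀ {σ} → List (Fin σ) → Set
Distinct = Unique

distinct? : ∀ {σ} → Decidable (Distinct {σ})
distinct? = UD.unique? _≟F_

allStrings : (σ b : ℕ) → List (Vec (Fin σ) b)
allStrings σ zero = []ᵥ ∷ []
allStrings σ (suc b) = concatMap (λ c → map (c ∷ᵥ_) (allStrings σ b)) (allFin σ)

module Shift {σ k m : ℕ} (P : Fin k → Vec (Fin σ) m) (b : ℕ) where

  occursAt : List (Fin σ) → ℕ → Bool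
  occursAt x j = any (λ i → does (≡-dec _≟ℕ_ (Pre (substr (toList (P i)) (suc j ∸ b) j)) (Pre x))) (allFin k)

  positions : List ℕ
  positions = map (b +_) (upTo (suc (m ∸ b)))

  maximum : List ℕ → Maybe ℕ
  maximum [] = nothing
  maximum (j ∷ js) = just (maybe (j ⊔_) j (maximum js))

  -- l_x (nothing represents -∞)
  lx : List (Fin σ) → Maybe ℕ
  lx x = maximum (filter (λ j → Data.Bool.T? (occursAt x j)) positions)

  -- shift value min(m - l_x, m - b + 1), where m - (-∞) = +∞
  shift : Vec (Fin σ) b → ℕ
  shift x = maybe (λ l → (m ∸ l) ⊓ (suc m ∸ b)) (suc m ∸ b) (lx (toList x))

module Submission where

-- Pre x only records the relative order of the letters of x. Call x admissible over s if its letters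
-- are distinct and smaller than s. Each class of admissible strings of length b sharing one Pre
-- contains at most a 1/b! fraction of all of them, by induction on s with M = s the new letter:
-- deleting M maps the members of a class that contain M injectively into a single class of length b
-- (M carries the largest entry of Pre, which pins down its position), and inserting M at one of the
-- b + 1 positions of an admissible string over s is injective. If x has shift value j ≤ m - b then
-- l_x = m - j, so Pre x is the Pre of one of the k windows P_i[m-j-b+1..m-j], and summing the bound
-- over these k classes gives the theorem.

open import Defs
open import Data.Bool using (T; T?)
open import Data.Empty using (⊥-elim)
open import Data.Fin as F using (Fin; toℕ)
import Data.Fin.Properties as FP
open import Data.List
open import Data.List.Properties
open import Data.List.Membership.Propositional using (_∈_; _∉_)
open import Data.List.Membership.Propositional.Properties
import Data.List.Membership.DecPropositional as DecMembership
open import Data.List.Relation.Unary.All as All using (All; []; _∷_)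
import Data.List.Relation.Unary.All.Properties as AllP
open import Data.List.Relation.Unary.AllPairs using ([]; _∷_)
open import Data.List.Relation.Unary.Any as Any using (here; there)
open import Data.List.Relation.Unary.Any.Properties using (any⁻)
open import Data.List.Relation.Unary.Unique.Propositional using (Unique)
import Data.List.Relation.Unary.Unique.Propositional.Properties as Uniqueₚ
open import Data.Maybe using (just; nothing)
open import Data.Maybe.Properties using (just-injective)
open import Data.Nat using (ℕ; zero; suc; _+_; _*_; _∸_; _≤_; _<_; z≤n; s≤s; _!)
open import Data.Nat.Properties
open import Data.Product using (∃; ∃₂; _×_; _,_; proj₁; proj₂)
open import Data.Sum using (_⊎_; inj₁; inj₂)
open import Data.Vec as V using (Vec; toList)
import Data.Vec.Properties as VP
open import Function using (_∘_; id)
open import Relation.Binary.Definitions using (tri<; tri≈; tri>)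
open import Relation.Binary.PropositionalEquality hiding ([_])
open import Relation.Nullary using (¬_; yes; no; ¬?; _×-dec_)
open import Relation.Nullary.Decidable using (toWitness; isYes≗does)
open import Relation.Unary using (Pred; Decidable)

module _ {a} {A : Set a} where

  ∈-insert⁻ : ∀ (u : List A) {z c v} → c ∈ u ++ z ∷ v → c ≡ z ⊎ c ∈ u ++ v
  ∈-insert⁻ [] (here e) = inj₁ e
  ∈-insert⁻ [] (there p) = inj₂ p
  ∈-insert⁻ (x ∷ u) (here e) = inj₂ (here e)
  ∈-insert⁻ (x ∷ u) (there p) with ∈-insert⁻ u p
  ... | inj₁ e = inj₁ e
  ... | inj₂ q = inj₂ (there q)

  All-insert⁻ : ∀ {p} {P : Pred A p} (u : List A) {z v} → All P (u ++ z ∷ v) → All P (u ++ v)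
  All-insert⁻ [] (_ ∷ h) = h
  All-insert⁻ (x ∷ u) (h ∷ hs) = h ∷ All-insert⁻ u hs

  All-insert⁺ : ∀ {p} {P : Pred A p} (u : List A) {z v} → All P (u ++ v) → P z → All P (u ++ z ∷ v)
  All-insert⁺ [] h pz = pz ∷ h
  All-insert⁺ (x ∷ u) (h ∷ hs) pz = h ∷ All-insert⁺ u hs pz

  Unique-insert⁻ : ∀ (u : List A) {z v} → Unique (u ++ z ∷ v) → Unique (u ++ v)
  Unique-insert⁻ [] (_ ∷ h) = h
  Unique-insert⁻ (x ∷ u) (h ∷ hs) = All-insert⁻ u h ∷ Unique-insert⁻ u hs

  Unique-insert⁺ : ∀ (u : List A) {z v} → Unique (u ++ v) → z ∉ u ++ v → Unique (u ++ z ∷ v)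
  Unique-insert⁺ [] h z∉ = All.tabulate (λ p e → z∉ (subst (_∈ _) (sym e) p)) ∷ h
  Unique-insert⁺ (x ∷ u) (h ∷ hs) z∉ =
    All-insert⁺ u h (λ e → z∉ (here (sym e))) ∷ Unique-insert⁺ u hs (λ p → z∉ (there p))

  Unique-++⁻ʳ : ∀ (u : List A) {w} → Unique (u ++ w) → Unique w
  Unique-++⁻ʳ [] h = h
  Unique-++⁻ʳ (x ∷ u) (_ ∷ hs) = Unique-++⁻ʳ u hs

  ++-injective : ∀ (xs xs' : List A) {ys ys'} → xs ++ ys ≡ xs' ++ ys' →
    length xs ≡ length xs' → xs ≡ xs' × ys ≡ ys'
  ++-injective [] [] e _ = refl , e
  ++-injective (x ∷ xs) (x' ∷ xs') e l with ++-injective xs xs' (∷-injectiveʳ e) (suc-injective l)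
  ... | e₁ , e₂ = cong₂ _∷_ (∷-injectiveˡ e) e₁ , e₂

  insert-injective : ∀ (u u' : List A) {z v v'} → z ∉ u → z ∉ u' →
    u ++ z ∷ v ≡ u' ++ z ∷ v' → u ≡ u' × v ≡ v'
  insert-injective [] [] _ _ e = refl , ∷-injectiveʳ e
  insert-injective [] (c ∷ u') _ z∉u' e = ⊥-elim (z∉u' (here (∷-injectiveˡ e)))
  insert-injective (c ∷ u) [] z∉u _ e = ⊥-elim (z∉u (here (sym (∷-injectiveˡ e))))
  insert-injective (c ∷ u) (c' ∷ u') z∉u z∉u' e
    with insert-injective u u' (z∉u ∘ there) (z∉u' ∘ there) (∷-injectiveʳ e)
  ... | e₁ , e₂ = cong₂ _∷_ (∷-injectiveˡ e) e₁ , e₂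

  insert-shorter : ∀ (xs₁ xs₂ : List A) {a b ys₁ ys₂} → xs₁ ++ a ∷ ys₁ ≡ xs₂ ++ b ∷ ys₂ →
    length xs₁ < length xs₂ → ∃ λ R → ys₁ ≡ R ++ b ∷ ys₂ × suc (length xs₁ + length R) ≡ length xs₂
  insert-shorter [] (c ∷ xs₂) e _ = xs₂ , ∷-injectiveʳ e , refl
  insert-shorter (c ∷ xs₁) (d ∷ xs₂) e (s≤s lt) with insert-shorter xs₁ xs₂ (∷-injectiveʳ e) lt
  ... | R , e₁ , e₂ = R , e₁ , cong suc e₂

module _ {a b} {A : Set a} {B : Set b} where

  length-≤-injection : (f : A → B) (xs : List A) (ys : List B) → Unique xs →
    (∀ {x} → x ∈ xs → f x ∈ ys) → (∀ {x y} → x ∈ xs → y ∈ xs → f x ≡ f y → x ≡ y) →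
    length xs ≤ length ys
  length-≤-injection f [] ys _ _ _ = z≤n
  length-≤-injection f (x ∷ xs) ys (x∉xs ∷ xs!) into inj
    with ys₁ , ys₂ , refl ← ∈-∃++ (into (here refl)) =
    subst (suc (length xs) ≤_) (sym (length-++-sucʳ ys₁ (f x) ys₂))
      (s≤s (length-≤-injection f xs (ys₁ ++ ys₂) xs! into′ inj′))
    where
    into′ : ∀ {y} → y ∈ xs → f y ∈ ys₁ ++ ys₂
    into′ {y} y∈ with ∈-insert⁻ ys₁ (into (there y∈))
    ... | inj₁ fy≡fx = ⊥-elim (All.lookup x∉xs y∈ (sym (inj (there y∈) (here refl) fy≡fx)))
    ... | inj₂ fy∈ = fy∈
    inj′ : ∀ {y z} → y ∈ xs → z ∈ xs → f y ≡ f z → y ≡ z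
    inj′ p q = inj (there p) (there q)

  length-cartesianProduct : (xs : List A) (ys : List B) →
    length (cartesianProduct xs ys) ≡ length xs * length ys
  length-cartesianProduct [] ys = refl
  length-cartesianProduct (x ∷ xs) ys = trans (length-++ (map (x ,_) ys))
    (cong₂ _+_ (length-map (x ,_) ys) (length-cartesianProduct xs ys))

  length-concatMap-* : (g : A → List B) (c d : ℕ) → (∀ x → length (g x) * c ≤ d) →
    ∀ xs → length (concatMap g xs) * c ≤ length xs * d
  length-concatMap-* g c d h [] = z≤n
  length-concatMap-* g c d h (x ∷ xs) = begin
    length (g x ++ concatMap g xs) * c            ≡⟨ cong (_* c) (length-++ (g x)) ⟩
    (length (g x) + length (concatMap g xs)) * c  ≡⟨ *-distribʳ-+ c (length (g x)) _ ⟩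
    length (g x) * c + length (concatMap g xs) * c ≤⟨ +-mono-≤ (h x) (length-concatMap-* g c d h xs) ⟩
    d + length xs * d                             ∎
    where open ≤-Reasoning

  length-filter-map : ∀ {p} {Q : Pred B p} (f : A → B) (Q? : Decidable Q) xs →
    length (filter (Q? ∘ f) xs) ≡ length (filter Q? (map f xs))
  length-filter-map f Q? [] = refl
  length-filter-map f Q? (x ∷ xs) with Q? (f x)
  ... | yes _ = cong suc (length-filter-map f Q? xs)
  ... | no _ = length-filter-map f Q? xs

module _ {a p q} {A : Set a} {P : Pred A p} {Q : Pred A q} (P? : Decidable P) (Q? : Decidable Q) where

  length-filter-mono : (∀ {x} → P x → Q x) → ∀ xs → length (filter P? xs) ≤ length (filter Q? xs)
  length-filter-mono P⇒Q [] = z≤n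
  length-filter-mono P⇒Q (x ∷ xs) with P? x | Q? x
  ... | yes px | yes _ = s≤s (length-filter-mono P⇒Q xs)
  ... | yes px | no ¬qx = ⊥-elim (¬qx (P⇒Q px))
  ... | no _ | yes _ = m≤n⇒m≤1+n (length-filter-mono P⇒Q xs)
  ... | no _ | no _ = length-filter-mono P⇒Q xs

  length-filter-split : ∀ xs → length (filter P? xs) ≡
    length (filter (λ x → P? x ×-dec Q? x) xs) + length (filter (λ x → P? x ×-dec ¬? (Q? x)) xs)
  length-filter-split [] = refl
  length-filter-split (x ∷ xs) with P? x | Q? x
  ... | yes _ | yes _ = cong suc (length-filter-split xs)
  ... | yes _ | no _ = trans (cong suc (length-filter-split xs)) (sym (+-suc _ _))
  ... | no _ | yes _ = length-filter-split xs
  ... | no _ | no _ = length-filter-split xs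

allStrings-suc : ∀ σ b (cs : List (Fin σ)) →
  concatMap (λ c → map (c V.∷_) (allStrings σ b)) cs ≡ cartesianProductWith V._∷_ cs (allStrings σ b)
allStrings-suc σ b [] = refl
allStrings-suc σ b (c ∷ cs) = cong (map (c V.∷_) (allStrings σ b) ++_) (allStrings-suc σ b cs)

allStrings-unique : ∀ σ b → Unique (allStrings σ b)
allStrings-unique σ zero = [] ∷ []
allStrings-unique σ (suc b) = subst Unique (sym (allStrings-suc σ b (allFin σ)))
  (Uniqueₚ.cartesianProductWith⁺ V._∷_ VP.∷-injective (Uniqueₚ.allFin⁺ σ) (allStrings-unique σ b))

∈-allStrings : ∀ σ b (x : Vec (Fin σ) b) → x ∈ allStrings σ b
∈-allStrings σ zero V.[] = here refl
∈-allStrings σ (suc b) (c V.∷ x) = subst (_ ∈_) (sym (allStrings-suc σ b (allFin σ)))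
  (∈-cartesianProductWith⁺ V._∷_ (∈-allFin c) (∈-allStrings σ b x))

toList-injective : ∀ {a} {A : Set a} {n} {x y : Vec A n} → toList x ≡ toList y → x ≡ y
toList-injective {x = x} {y} e = trans (sym (VP.cast-is-id refl x)) (VP.toList-injective refl x y e)

words : ∀ σ b → List (List (Fin σ))
words σ b = map toList (allStrings σ b)

words-unique : ∀ σ b → Unique (words σ b)
words-unique σ b = Uniqueₚ.map⁺ toList-injective (allStrings-unique σ b)

∈-words : ∀ {σ b} (l : List (Fin σ)) → length l ≡ b → l ∈ words σ b
∈-words {σ} l refl = subst (_∈ words σ (length l)) (VP.toList∘fromList l)
  (∈-map⁺ toList (∈-allStrings σ (length l) (V.fromList l)))

∈-words⇒length : ∀ {σ b} {l : List (Fin σ)} → l ∈ words σ b → length l ≡ b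
∈-words⇒length l∈ with x , _ , refl ← ∈-map⁻ toList l∈ = VP.length-toList x

private variable σ : ℕ

length-∷ʳ : ∀ {a} {A : Set a} (xs : List A) x → length (xs ++ [ x ]) ≡ suc (length xs)
length-∷ʳ xs x = trans (length-++ xs) (+-comm (length xs) 1)

preAux-++ : ∀ (acc u w : List (Fin σ)) → preAux acc (u ++ w) ≡ preAux acc u ++ preAux (acc ++ u) w
preAux-++ acc [] w = cong (λ z → preAux z w) (sym (++-identityʳ acc))
preAux-++ acc (c ∷ u) w = cong (rank (acc ++ [ c ]) c ∷_)
  (trans (preAux-++ (acc ++ [ c ]) u w)
         (cong (λ z → preAux (acc ++ [ c ]) u ++ preAux z w) (++-assoc acc [ c ] u)))

length-preAux : ∀ (acc u : List (Fin σ)) → length (preAux acc u) ≡ length u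
length-preAux acc [] = refl
length-preAux acc (c ∷ u) = cong suc (length-preAux (acc ++ [ c ]) u)

rank-∷ʳ : ∀ (acc : List (Fin σ)) c → rank (acc ++ [ c ]) c ≡ suc (length (filter (F._<? c) acc))
rank-∷ʳ acc c = cong (suc ∘ length) (begin
  filter <c? (acc ++ [ c ])          ≡⟨ filter-++ <c? acc [ c ] ⟩
  filter <c? acc ++ filter <c? [ c ] ≡⟨ cong (filter <c? acc ++_) (filter-reject <c? (<-irrefl refl)) ⟩
  filter <c? acc ++ []               ≡⟨ ++-identityʳ _ ⟩
  filter <c? acc                     ∎)
  where
  open ≡-Reasoning
  <c? : Decidable (F._< c)
  <c? = F._<? c

rank-∷ʳ-max : ∀ (acc : List (Fin σ)) M → All (F._< M) acc → rank (acc ++ [ M ]) M ≡ suc (length acc)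
rank-∷ʳ-max acc M acc<M = trans (rank-∷ʳ acc M) (cong (suc ∘ length) (filter-all (F._<? M) acc<M))

preAux-remove-max : ∀ M (A B v : List (Fin σ)) → All (λ c → ¬ (M F.< c)) v →
  preAux (A ++ M ∷ B) v ≡ preAux (A ++ B) v
preAux-remove-max M A B [] _ = refl
preAux-remove-max M A B (c ∷ v) (M≮c ∷ v≤M) = cong₂ _∷_ rank-eq (begin
  preAux ((A ++ M ∷ B) ++ [ c ]) v ≡⟨ cong (λ z → preAux z v) (++-assoc A (M ∷ B) [ c ]) ⟩
  preAux (A ++ M ∷ B ++ [ c ]) v   ≡⟨ preAux-remove-max M A (B ++ [ c ]) v v≤M ⟩
  preAux (A ++ B ++ [ c ]) v       ≡⟨ cong (λ z → preAux z v) (++-assoc A B [ c ]) ⟨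
  preAux ((A ++ B) ++ [ c ]) v     ∎)
  where
  open ≡-Reasoning
  <c? : Decidable (F._< c)
  <c? = F._<? c
  rank-eq : rank ((A ++ M ∷ B) ++ [ c ]) c ≡ rank ((A ++ B) ++ [ c ]) c
  rank-eq = begin
    rank ((A ++ M ∷ B) ++ [ c ]) c                   ≡⟨ rank-∷ʳ (A ++ M ∷ B) c ⟩
    suc (length (filter <c? (A ++ M ∷ B)))           ≡⟨ cong (suc ∘ length) (filter-++ <c? A (M ∷ B)) ⟩
    suc (length (filter <c? A ++ filter <c? (M ∷ B)))
      ≡⟨ cong (λ z → suc (length (filter <c? A ++ z))) (filter-reject <c? M≮c) ⟩
    suc (length (filter <c? A ++ filter <c? B))      ≡⟨ cong (suc ∘ length) (filter-++ <c? A B) ⟨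
    suc (length (filter <c? (A ++ B)))               ≡⟨ rank-∷ʳ (A ++ B) c ⟨
    rank ((A ++ B) ++ [ c ]) c                       ∎

rank-∷ʳ-≤ : ∀ (acc : List (Fin σ)) c → rank (acc ++ [ c ]) c ≤ suc (length acc)
rank-∷ʳ-≤ acc c = subst (_≤ suc (length acc)) (sym (rank-∷ʳ acc c)) (s≤s (length-filter (F._<? c) acc))

preAux-entry-bound : ∀ (acc v : List (Fin σ)) R {a T} → preAux acc v ≡ R ++ a ∷ T →
  a ≤ suc (length acc + length R)
preAux-entry-bound acc (c ∷ v) [] {a} e = begin
  a                         ≡⟨ ∷-injectiveˡ e ⟨
  rank (acc ++ [ c ]) c     ≤⟨ rank-∷ʳ-≤ acc c ⟩
  suc (length acc)          ≡⟨ cong suc (+-identityʳ _) ⟨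
  suc (length acc + 0)      ∎
  where open ≤-Reasoning
preAux-entry-bound acc (c ∷ v) (r ∷ R) {a} e = begin
  a                                      ≤⟨ preAux-entry-bound (acc ++ [ c ]) v R (∷-injectiveʳ e) ⟩
  suc (length (acc ++ [ c ]) + length R) ≡⟨ cong (λ n → suc (n + length R)) (length-∷ʳ acc c) ⟩
  suc (suc (length acc + length R))      ≡⟨ cong suc (+-suc (length acc) (length R)) ⟨
  suc (length acc + suc (length R))      ∎
  where open ≤-Reasoning

Below : ℕ → List (Fin σ) → Set
Below s = All (λ c → toℕ c < s)

Admissible : ℕ → List (Fin σ) → Set
Admissible s l = Distinct l × Below s l

admissible? : ∀ s → Decidable (Admissible {σ} s)
admissible? s l = distinct? l ×-dec All.all? (λ c → toℕ c <? s) l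

hasPattern? : ∀ s p → Decidable (λ (l : List (Fin σ)) → Admissible s l × Pre l ≡ p)
hasPattern? s p l = admissible? s l ×-dec ≡-dec _≟_ (Pre l) p

#admissible : ∀ σ → ℕ → ℕ → ℕ
#admissible σ s b = length (filter (admissible? s) (words σ b))

#pattern : ∀ σ → ℕ → ℕ → List ℕ → ℕ
#pattern σ s b p = length (filter (hasPattern? s p) (words σ b))

module InsertMax {σ} (s : ℕ) (M : Fin σ) (M≡s : toℕ M ≡ s) where

  private variable u v u' v' l : List (Fin σ)

  below⇒<M : Below s l → All (F._< M) l
  below⇒<M = All.map (λ {c} → subst (toℕ c <_) (sym M≡s))

  below⇒≯M : Below s l → All (λ c → ¬ (M F.< c)) l
  below⇒≯M = All.map (λ {c} c<s M<c → <-asym M<c (subst (toℕ c <_) (sym M≡s) c<s))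

  below⇒∌M : Below s l → M ∉ l
  below⇒∌M l<s M∈l = <-irrefl M≡s (All.lookup l<s M∈l)

  below-suc⇒below : Below (suc s) l → M ∉ l → Below s l
  below-suc⇒below {l = l} l≤s M∉l = All.tabulate λ {c} c∈l →
    ≤∧≢⇒< (m<1+n⇒m≤n (All.lookup l≤s c∈l))
          (λ c≡s → M∉l (subst (_∈ l) (FP.toℕ-injective (trans c≡s (sym M≡s))) c∈l))

  Pre-insertMax : Below s u → Below s v →
    Pre (u ++ M ∷ v) ≡ Pre u ++ suc (length u) ∷ preAux u v
  Pre-insertMax {u = u} {v = v} u<s v<s = begin
    Pre (u ++ M ∷ v)                                     ≡⟨ preAux-++ [] u (M ∷ v) ⟩
    Pre u ++ rank (u ++ [ M ]) M ∷ preAux (u ++ [ M ]) v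
      ≡⟨ cong₂ (λ r w → Pre u ++ r ∷ w) rank-M preAux-v ⟩
    Pre u ++ suc (length u) ∷ preAux u v                 ∎
    where
    open ≡-Reasoning
    rank-M : rank (u ++ [ M ]) M ≡ suc (length u)
    rank-M = rank-∷ʳ-max u M (below⇒<M u<s)
    preAux-v : preAux (u ++ [ M ]) v ≡ preAux u v
    preAux-v = trans (preAux-remove-max M u [] v (below⇒≯M v<s))
      (cong (λ z → preAux z v) (++-identityʳ u))

  -- The entry of M is 1 + |u|, while the entry of preAux u v at offset i is at most 1 + |u| + i,
  -- so an equal pattern cannot have M further to the right.
  insertMax-not-shorter : Below s u → Below s v → Below s u' → Below s v' →
    Pre (u ++ M ∷ v) ≡ Pre (u' ++ M ∷ v') → ¬ (length u < length u')
  insertMax-not-shorter {u = u} {v = v} {u' = u'} {v' = v'} u<s v<s u'<s v'<s e |u|<|u'|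
    with R , v≡R++ , |R|≡ ← insert-shorter (Pre u) (Pre u')
           (trans (sym (Pre-insertMax u<s v<s)) (trans e (Pre-insertMax u'<s v'<s)))
           (subst₂ _<_ (sym (length-preAux [] u)) (sym (length-preAux [] u')) |u|<|u'|)
    = <-irrefl refl (begin-strict
      length u'                  <⟨ preAux-entry-bound u v R v≡R++ ⟩
      suc (length u + length R)  ≡⟨ cong (λ n → suc (n + length R)) (length-preAux [] u) ⟨
      suc (length (Pre u) + length R) ≡⟨ |R|≡ ⟩
      length (Pre u')            ≡⟨ length-preAux [] u' ⟩
      length u'                  ∎)
    where open ≤-Reasoning

  Pre-insertMax-injective : Below s u → Below s v → Below s u' → Below s v' →
    Pre (u ++ M ∷ v) ≡ Pre (u' ++ M ∷ v') → length u ≡ length u' × Pre (u ++ v) ≡ Pre (u' ++ v')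
  Pre-insertMax-injective {u = u} {v = v} {u' = u'} {v' = v'} u<s v<s u'<s v'<s e =
    |u|≡|u'| , (begin
      Pre (u ++ v)          ≡⟨ preAux-++ [] u v ⟩
      Pre u ++ preAux u v   ≡⟨ cong₂ _++_ (proj₁ split) (∷-injectiveʳ (proj₂ split)) ⟩
      Pre u' ++ preAux u' v' ≡⟨ preAux-++ [] u' v' ⟨
      Pre (u' ++ v')        ∎)
    where
    open ≡-Reasoning
    |u|≡|u'| : length u ≡ length u'
    |u|≡|u'| with <-cmp (length u) (length u')
    ... | tri< lt _ _ = ⊥-elim (insertMax-not-shorter u<s v<s u'<s v'<s e lt)
    ... | tri≈ _ eq _ = eq
    ... | tri> _ _ gt = ⊥-elim (insertMax-not-shorter u'<s v'<s u<s v<s (sym e) gt)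
    split : Pre u ≡ Pre u' × suc (length u) ∷ preAux u v ≡ suc (length u') ∷ preAux u' v'
    split = ++-injective (Pre u) (Pre u')
      (trans (sym (Pre-insertMax u<s v<s)) (trans e (Pre-insertMax u'<s v'<s)))
      (trans (length-preAux [] u) (trans |u|≡|u'| (sym (length-preAux [] u'))))

  deleteMax : List (Fin σ) → List (Fin σ)
  deleteMax [] = []
  deleteMax (c ∷ cs) with c F.≟ M
  ... | yes _ = cs
  ... | no _ = c ∷ deleteMax cs

  record MaxSplit (x : List (Fin σ)) : Set where
    field
      before after : List (Fin σ)
      x≡before++M∷after : x ≡ before ++ M ∷ after
      deleteMax≡before++after : deleteMax x ≡ before ++ after
      before<s : Below s before
      after<s : Below s after

  split-at-M : ∀ x → M ∈ x → ∃₂ λ u v → x ≡ u ++ M ∷ v × M ∉ u × deleteMax x ≡ u ++ v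
  split-at-M (c ∷ cs) M∈ with c F.≟ M
  ... | yes refl = [] , cs , refl , (λ ()) , refl
  split-at-M (c ∷ cs) (here M≡c) | no c≢M = ⊥-elim (c≢M (sym M≡c))
  split-at-M (c ∷ cs) (there M∈cs) | no c≢M
    with u , v , cs≡ , M∉u , del≡ ← split-at-M cs M∈cs
    = c ∷ u , v , cong (c ∷_) cs≡ , (λ { (here M≡c) → c≢M (sym M≡c) ; (there M∈u) → M∉u M∈u }) ,
      cong (c ∷_) del≡

  maxSplit : Admissible (suc s) l → M ∈ l → MaxSplit l
  maxSplit {l = l} (l! , l≤s) M∈l with split-at-M l M∈l
  ... | u , v , refl , M∉u , del≡ = record
    { before = u ; after = v ; x≡before++M∷after = refl ; deleteMax≡before++after = del≡
    ; before<s = below-suc⇒below (AllP.++⁻ˡ u l≤s) M∉u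
    ; after<s = below-suc⇒below (All.tail (AllP.++⁻ʳ u l≤s)) M∉v
    }
    where
    M∉v : M ∉ v
    M∉v with M∉v′ ∷ _ ← Unique-++⁻ʳ u l! = λ M∈v → All.lookup M∉v′ M∈v refl

  Pre-deleteMax : ∀ {x y} (X : MaxSplit x) (Y : MaxSplit y) → Pre x ≡ Pre y →
    length (MaxSplit.before X) ≡ length (MaxSplit.before Y) × Pre (deleteMax x) ≡ Pre (deleteMax y)
  Pre-deleteMax X Y Px≡Py = proj₁ inj , trans (cong Pre X.deleteMax≡before++after)
      (trans (proj₂ inj) (cong Pre (sym Y.deleteMax≡before++after)))
    where
    module X = MaxSplit X
    module Y = MaxSplit Y
    inj : length X.before ≡ length Y.before × Pre (X.before ++ X.after) ≡ Pre (Y.before ++ Y.after)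
    inj = Pre-insertMax-injective X.before<s X.after<s Y.before<s Y.after<s
      (trans (cong Pre (sym X.x≡before++M∷after)) (trans Px≡Py (cong Pre Y.x≡before++M∷after)))

  deleteMax-injective : ∀ {x y} (X : MaxSplit x) (Y : MaxSplit y) → Pre x ≡ Pre y →
    deleteMax x ≡ deleteMax y → x ≡ y
  deleteMax-injective {x} {y} X Y Px≡Py del≡ = begin
    x                        ≡⟨ X.x≡before++M∷after ⟩
    X.before ++ M ∷ X.after  ≡⟨ cong₂ (λ u v → u ++ M ∷ v) (proj₁ parts) (proj₂ parts) ⟩
    Y.before ++ M ∷ Y.after  ≡⟨ Y.x≡before++M∷after ⟨
    y                        ∎
    where
    open ≡-Reasoning
    module X = MaxSplit X
    module Y = MaxSplit Y
    parts : X.before ≡ Y.before × X.after ≡ Y.after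
    parts = ++-injective X.before Y.before
      (trans (sym X.deleteMax≡before++after) (trans del≡ Y.deleteMax≡before++after))
      (proj₁ (Pre-deleteMax X Y Px≡Py))

  open DecMembership (F._≟_ {σ}) using (_∈?_)

  module Count (b : ℕ) where

    withMax? : ∀ p → Decidable (λ x → (Admissible (suc s) x × Pre x ≡ p) × M ∈ x)
    withMax? p x = hasPattern? (suc s) p x ×-dec M ∈? x

    withoutMax? : ∀ p → Decidable (λ x → (Admissible (suc s) x × Pre x ≡ p) × M ∉ x)
    withoutMax? p x = hasPattern? (suc s) p x ×-dec ¬? (M ∈? x)

    admissibleWithMax? : Decidable (λ x → Admissible (suc s) x × M ∈ x)
    admissibleWithMax? x = admissible? (suc s) x ×-dec M ∈? x

    admissibleWithoutMax? : Decidable (λ x → Admissible (suc s) x × M ∉ x)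
    admissibleWithoutMax? x = admissible? (suc s) x ×-dec ¬? (M ∈? x)

    withMax-split : ∀ {p x} → x ∈ filter (withMax? p) (words σ (suc b)) →
      x ∈ words σ (suc b) × Distinct x × Pre x ≡ p × MaxSplit x
    withMax-split {p} x∈ with x∈ws , ((x-adm , Px≡p) , M∈x) ← ∈-filter⁻ (withMax? p) x∈ =
      x∈ws , proj₁ x-adm , Px≡p , maxSplit x-adm M∈x

    deleteMax-count : ∀ {p x₀} → x₀ ∈ filter (withMax? p) (words σ (suc b)) →
      length (filter (withMax? p) (words σ (suc b))) ≤ #pattern σ s b (Pre (deleteMax x₀))
    deleteMax-count {p} {x₀} x₀∈ = length-≤-injection deleteMax _ _
      (Uniqueₚ.filter⁺ (withMax? p) (words-unique σ (suc b))) into inj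
      where
      into : ∀ {x} → x ∈ filter (withMax? p) (words σ (suc b)) →
        deleteMax x ∈ filter (hasPattern? s (Pre (deleteMax x₀))) (words σ b)
      into {x} x∈ with x∈ws , x! , Px≡p , X ← withMax-split x∈ | _ , _ , Px₀≡p , X₀ ← withMax-split x₀∈ =
        ∈-filter⁺ (hasPattern? s _) (∈-words (deleteMax x) |del|≡b)
          ((del! , del<s) , proj₂ (Pre-deleteMax X X₀ (trans Px≡p (sym Px₀≡p))))
        where
        open MaxSplit X
        |del|≡b : length (deleteMax x) ≡ b
        |del|≡b = suc-injective (begin
          suc (length (deleteMax x))      ≡⟨ cong (suc ∘ length) deleteMax≡before++after ⟩
          suc (length (before ++ after))  ≡⟨ length-++-sucʳ before M after ⟨
          length (before ++ M ∷ after)    ≡⟨ cong length x≡before++M∷after ⟨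
          length x                        ≡⟨ ∈-words⇒length x∈ws ⟩
          suc b                           ∎)
          where open ≡-Reasoning
        del! : Distinct (deleteMax x)
        del! = subst Unique (sym deleteMax≡before++after)
          (Unique-insert⁻ before (subst Unique x≡before++M∷after x!))
        del<s : Below s (deleteMax x)
        del<s = subst (Below s) (sym deleteMax≡before++after) (AllP.++⁺ before<s after<s)
      inj : ∀ {x y} → x ∈ filter (withMax? p) (words σ (suc b)) →
        y ∈ filter (withMax? p) (words σ (suc b)) → deleteMax x ≡ deleteMax y → x ≡ y
      inj x∈ y∈ with _ , _ , Px≡p , X ← withMax-split x∈ | _ , _ , Py≡p , Y ← withMax-split y∈ =
        deleteMax-injective X Y (trans Px≡p (sym Py≡p))

    #pattern-withMax : ∀ p → (∀ p' → #pattern σ s b p' * b ! ≤ #admissible σ s b) →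
      length (filter (withMax? p) (words σ (suc b))) * b ! ≤ #admissible σ s b
    #pattern-withMax p IH with filter (withMax? p) (words σ (suc b)) in eq
    ... | [] = z≤n
    ... | x₀ ∷ _ = ≤-trans (*-monoˡ-≤ (b !) (subst (λ xs → length xs ≤ _) eq
            (deleteMax-count (subst (x₀ ∈_) (sym eq) (here refl))))) (IH _)

    #pattern-withoutMax : ∀ p →
      length (filter (withoutMax? p) (words σ (suc b))) ≤ #pattern σ s (suc b) p
    #pattern-withoutMax p = length-filter-mono (withoutMax? p) (hasPattern? s p)
      (λ (((x! , x≤s) , Px≡p) , M∉x) → (x! , below-suc⇒below x≤s M∉x) , Px≡p) (words σ (suc b))

    #admissible-withoutMax : #admissible σ s (suc b) ≤ length (filter admissibleWithoutMax? (words σ (suc b)))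
    #admissible-withoutMax = length-filter-mono (admissible? s) admissibleWithoutMax?
      (λ (x! , x<s) → (x! , All.map m<n⇒m<1+n x<s) , below⇒∌M x<s) (words σ (suc b))

    insertMaxAt : Fin (suc b) × List (Fin σ) → List (Fin σ)
    insertMaxAt (t , x) = take (toℕ t) x ++ M ∷ drop (toℕ t) x

    insertMaxAt-∈ : ∀ {t x} → x ∈ filter (admissible? s) (words σ b) →
      insertMaxAt (t , x) ∈ filter admissibleWithMax? (words σ (suc b))
    insertMaxAt-∈ {t} {x} x∈ with x∈ws , (x! , x<s) ← ∈-filter⁻ (admissible? s) x∈ =
      ∈-filter⁺ admissibleWithMax? (∈-words _ length≡)
        ((ins! , ins≤s) , ∈-++⁺ʳ (take (toℕ t) x) (here refl))
      where
      x≡ : take (toℕ t) x ++ drop (toℕ t) x ≡ x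
      x≡ = take++drop≡id (toℕ t) x
      length≡ : length (insertMaxAt (t , x)) ≡ suc b
      length≡ = trans (length-++-sucʳ (take (toℕ t) x) M _)
        (cong suc (trans (cong length x≡) (∈-words⇒length x∈ws)))
      ins! : Distinct (insertMaxAt (t , x))
      ins! = Unique-insert⁺ (take (toℕ t) x) (subst Unique (sym x≡) x!)
        (subst (M ∉_) (sym x≡) (below⇒∌M x<s))
      ins≤s : Below (suc s) (insertMaxAt (t , x))
      ins≤s = All-insert⁺ (take (toℕ t) x) (subst (Below (suc s)) (sym x≡) (All.map m<n⇒m<1+n x<s))
        (subst (_< suc s) (sym M≡s) (n<1+n s))

    insertMaxAt-injective : ∀ {t x t' y} → x ∈ filter (admissible? s) (words σ b) →
      y ∈ filter (admissible? s) (words σ b) →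
      insertMaxAt (t , x) ≡ insertMaxAt (t' , y) → (t , x) ≡ (t' , y)
    insertMaxAt-injective {t} {x} {t'} {y} x∈ y∈ e
      with x∈ws , (_ , x<s) ← ∈-filter⁻ (admissible? s) x∈
         | y∈ws , (_ , y<s) ← ∈-filter⁻ (admissible? s) y∈
      = cong₂ _,_ (FP.toℕ-injective t≡t') x≡y
      where
      M∉take : ∀ {z} (r : Fin (suc b)) → Below s z → M ∉ take (toℕ r) z
      M∉take {z} r z<s = below⇒∌M (AllP.take⁺ (toℕ r) z<s)
      parts : take (toℕ t) x ≡ take (toℕ t') y × drop (toℕ t) x ≡ drop (toℕ t') y
      parts = insert-injective (take (toℕ t) x) (take (toℕ t') y) (M∉take t x<s) (M∉take t' y<s) e
      length-take-toℕ : ∀ {z} (r : Fin (suc b)) → z ∈ words σ b → length (take (toℕ r) z) ≡ toℕ r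
      length-take-toℕ {z} r z∈ = trans (length-take (toℕ r) z)
        (m≤n⇒m⊓n≡m (subst (toℕ r ≤_) (sym (∈-words⇒length z∈)) (FP.toℕ≤pred[n] r)))
      t≡t' : toℕ t ≡ toℕ t'
      t≡t' = trans (sym (length-take-toℕ t x∈ws))
        (trans (cong length (proj₁ parts)) (length-take-toℕ t' y∈ws))
      x≡y : x ≡ y
      x≡y = trans (sym (take++drop≡id (toℕ t) x))
        (trans (cong₂ _++_ (proj₁ parts) (proj₂ parts)) (take++drop≡id (toℕ t') y))

    #admissible-withMax : suc b * #admissible σ s b ≤ length (filter admissibleWithMax? (words σ (suc b)))
    #admissible-withMax = begin
      suc b * #admissible σ s b
        ≡⟨ cong (_* #admissible σ s b) (length-tabulate {n = suc b} id) ⟨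
      length (allFin (suc b)) * #admissible σ s b
        ≡⟨ length-cartesianProduct (allFin (suc b)) (filter (admissible? s) (words σ b)) ⟨
      length (cartesianProduct (allFin (suc b)) (filter (admissible? s) (words σ b)))
        ≤⟨ length-≤-injection insertMaxAt _ _
             (Uniqueₚ.cartesianProduct⁺ (Uniqueₚ.allFin⁺ (suc b))
                                        (Uniqueₚ.filter⁺ (admissible? s) (words-unique σ b)))
             (λ tx∈ → insertMaxAt-∈ (proj₂ (∈-cartesianProduct⁻ (allFin (suc b)) _ tx∈)))
             (λ tx∈ ty∈ → insertMaxAt-injective (proj₂ (∈-cartesianProduct⁻ (allFin (suc b)) _ tx∈))
                                                (proj₂ (∈-cartesianProduct⁻ (allFin (suc b)) _ ty∈))) ⟩
      length (filter admissibleWithMax? (words σ (suc b))) ∎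
      where open ≤-Reasoning

  #pattern-step : (∀ b p → #pattern σ s b p * b ! ≤ #admissible σ s b) →
    ∀ b p → #pattern σ (suc s) (suc b) p * suc b ! ≤ #admissible σ (suc s) (suc b)
  #pattern-step IH b p = begin
    #pattern σ (suc s) (suc b) p * (suc b * b !)
      ≡⟨ cong (_* (suc b * b !)) (length-filter-split (hasPattern? (suc s) p) (M ∈?_) ws) ⟩
    (#with + #without) * (suc b * b !)
      ≡⟨ *-distribʳ-+ (suc b * b !) #with #without ⟩
    #with * (suc b * b !) + #without * (suc b * b !)
      ≤⟨ +-mono-≤ withMax-bound withoutMax-bound ⟩
    suc b * #admissible σ s b + #admissible σ s (suc b)
      ≤⟨ +-mono-≤ #admissible-withMax #admissible-withoutMax ⟩
    length (filter admissibleWithMax? ws) + length (filter admissibleWithoutMax? ws)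
      ≡⟨ length-filter-split (admissible? (suc s)) (M ∈?_) ws ⟨
    #admissible σ (suc s) (suc b) ∎
    where
    open ≤-Reasoning
    open Count b
    ws : List (List (Fin σ))
    ws = words σ (suc b)
    #with #without : ℕ
    #with = length (filter (withMax? p) ws)
    #without = length (filter (withoutMax? p) ws)
    withMax-bound : #with * (suc b * b !) ≤ suc b * #admissible σ s b
    withMax-bound = begin
      #with * (suc b * b !) ≡⟨ *-assoc #with (suc b) (b !) ⟨
      #with * suc b * b !   ≡⟨ cong (_* b !) (*-comm #with (suc b)) ⟩
      suc b * #with * b !   ≡⟨ *-assoc (suc b) #with (b !) ⟩
      suc b * (#with * b !) ≤⟨ *-monoʳ-≤ (suc b) (#pattern-withMax p (IH b)) ⟩
      suc b * #admissible σ s b ∎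
    withoutMax-bound : #without * (suc b * b !) ≤ #admissible σ s (suc b)
    withoutMax-bound = ≤-trans (*-monoˡ-≤ (suc b * b !) (#pattern-withoutMax p)) (IH (suc b) p)

#pattern-bound : ∀ s → s ≤ σ → ∀ b p → #pattern σ s b p * b ! ≤ #admissible σ s b
#pattern-bound {σ} s _ zero p = subst (_≤ #admissible σ s 0) (sym (*-identityʳ _))
  (length-filter-mono (hasPattern? s p) (admissible? s) proj₁ (words σ 0))
#pattern-bound {σ} zero _ (suc b) p =
  subst (λ xs → length xs * suc b ! ≤ _)
    (sym (filter-none (hasPattern? 0 p) (All.tabulate nonempty))) z≤n
  where
  nonempty : ∀ {l} → l ∈ words σ (suc b) → ¬ (Admissible 0 l × Pre l ≡ p)
  nonempty {[]} l∈ with () ← ∈-words⇒length l∈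
  nonempty {c ∷ _} _ ((_ , () ∷ _) , _)
#pattern-bound (suc s) s<σ (suc b) p =
  InsertMax.#pattern-step s (F.fromℕ< s<σ) (FP.toℕ-fromℕ< s<σ) (#pattern-bound s (<⇒≤ s<σ)) b p

module _ {σ k m} (P : Fin k → Vec (Fin σ) m) (b : ℕ) where
  open Shift P b

  maximum-∈ : ∀ xs {L} → maximum xs ≡ just L → L ∈ xs
  maximum-∈ (x ∷ xs) e with maximum xs in eq
  ... | nothing = here (sym (just-injective e))
  ... | just L′ with ⊔-sel x L′
  ...   | inj₁ x⊔L′≡x = here (trans (sym (just-injective e)) x⊔L′≡x)
  ...   | inj₂ x⊔L′≡L′ =
    there (maximum-∈ xs (trans eq (cong just (trans (sym x⊔L′≡L′) (just-injective e)))))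

  window : Fin k → ℕ → List (Fin σ)
  window i l = substr (toList (P i)) (suc l ∸ b) l

  ∈-positions⇒≤ : b ≤ m → ∀ {l} → l ∈ positions → l ≤ m
  ∈-positions⇒≤ b≤m l∈ with t , t∈ , refl ← ∈-map⁻ (b +_) l∈ =
    ≤-trans (+-monoʳ-≤ b (m<1+n⇒m≤n (∈-upTo⁻ t∈))) (≤-reflexive (m+[n∸m]≡n b≤m))

  full-shift≢ : b ≤ m → ∀ {j} → j ≤ m ∸ b → suc m ∸ b ≢ j
  full-shift≢ b≤m j≤m∸b e = <⇒≱ (≤-reflexive (trans (sym (+-∸-assoc 1 b≤m)) e)) j≤m∸b

  shift≡⇒occurs : b ≤ m → (x : Vec (Fin σ) b) → ∀ j → j ≤ m ∸ b → shift x ≡ j →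
    ∃ λ i → Pre (toList x) ≡ Pre (window i (m ∸ j))
  shift≡⇒occurs b≤m x j j≤m∸b shift≡j with lx (toList x) in lx≡
  ... | nothing = ⊥-elim (full-shift≢ b≤m j≤m∸b shift≡j)
  ... | just L
    with L∈positions , occurs ← ∈-filter⁻ (λ l → T? (occursAt (toList x) l)) (maximum-∈ _ lx≡)
    with i , window≈x ← Any.satisfied (any⁻ _ (allFin k) occurs)
    = i , sym (subst (λ l → Pre (window i l) ≡ Pre (toList x)) L≡m∸j window-matches)
    where
    window-matches : Pre (window i L) ≡ Pre (toList x)
    window-matches = toWitness
      (subst T (sym (isYes≗does (≡-dec _≟_ (Pre (window i L)) (Pre (toList x))))) window≈x)
    m∸L≡j : m ∸ L ≡ j
    m∸L≡j with ⊓-sel (m ∸ L) (suc m ∸ b)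
    ... | inj₁ min≡m∸L = trans (sym min≡m∸L) shift≡j
    ... | inj₂ min≡top = ⊥-elim (full-shift≢ b≤m j≤m∸b (trans (sym min≡top) shift≡j))
    L≡m∸j : L ≡ m ∸ j
    L≡m∸j = trans (sym (m∸[m∸n]≡n (∈-positions⇒≤ b≤m L∈positions))) (cong (m ∸_) m∸L≡j)

  windowClasses : ℕ → Fin k → List (List (Fin σ))
  windowClasses l i = filter (hasPattern? σ (Pre (window i l))) (words σ b)

  #shift≤#windowClasses : b ≤ m → ∀ j → j ≤ m ∸ b →
    length (filter (λ x → distinct? (toList x) ×-dec (shift x ≟ j)) (allStrings σ b))
      ≤ length (concatMap (windowClasses (m ∸ j)) (allFin k))
  #shift≤#windowClasses b≤m j j≤m∸b = length-≤-injection toList _ _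
    (Uniqueₚ.filter⁺ _ (allStrings-unique σ b)) into
    (λ _ _ → toList-injective)
    where
    into : ∀ {x} → x ∈ filter (λ x → distinct? (toList x) ×-dec (shift x ≟ j)) (allStrings σ b) →
      toList x ∈ concatMap (windowClasses (m ∸ j)) (allFin k)
    into {x} x∈
      with x∈all , (x! , shift≡j) ← ∈-filter⁻ (λ x → distinct? (toList x) ×-dec (shift x ≟ j))
                                              {xs = allStrings σ b} x∈
      with i , x≈window ← shift≡⇒occurs b≤m x j j≤m∸b shift≡j
      = ∈-concatMap⁺ (windowClasses (m ∸ j)) (Any.map (λ { refl →
          ∈-filter⁺ (hasPattern? σ (Pre (window i (m ∸ j)))) {xs = words σ b} (∈-map⁺ toList x∈all)
            ((x! , All.tabulate λ {c} _ → FP.toℕ<n c) , x≈window) })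
          (∈-allFin i))

-- The bound holds for every pattern class.
lemma4 : (σ k m b : ℕ) → (P : Fin k → Vec (Fin σ) m) →
    1 ≤ b → b ≤ m → b ≤ σ →
    ((i : Fin k) → (s : ℕ) → s + b ≤ m → Distinct (take b (drop s (toList (P i))))) →
    (j : ℕ) → j ≤ m ∸ b →
    length (filter (λ x → distinct? (toList x) ×-dec (Shift.shift P b x ≟ j)) (allStrings σ b)) * (b !)
      ≤ k * length (filter (λ x → distinct? (toList x)) (allStrings σ b))
lemma4 σ k m b P _ b≤m _ _ j j≤m∸b = begin
  length (filter (λ x → distinct? (toList x) ×-dec (Shift.shift P b x ≟ j)) (allStrings σ b)) * b !
    ≤⟨ *-monoˡ-≤ (b !) (#shift≤#windowClasses P b b≤m j j≤m∸b) ⟩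
  length (concatMap (windowClasses P b (m ∸ j)) (allFin k)) * b !
    ≤⟨ length-concatMap-* (windowClasses P b (m ∸ j)) (b !) (#admissible σ σ b)
         (λ i → #pattern-bound σ ≤-refl b _) (allFin k) ⟩
  length (allFin k) * #admissible σ σ b
    ≡⟨ cong (_* #admissible σ σ b) (length-tabulate {n = k} id) ⟩
  k * #admissible σ σ b
    ≤⟨ *-monoʳ-≤ k (length-filter-mono (admissible? σ) distinct? proj₁ (words σ b)) ⟩
  k * length (filter distinct? (words σ b))
    ≡⟨ cong (k *_) (length-filter-map toList distinct? (allStrings σ b)) ⟨
  k * length (filter (λ x → distinct? (toList x)) (allStrings σ b)) ∎
  where open ≤-Reasoning
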